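{- Let $G=(V,E)$ be a strongly connected directed graph and $s\in V$. Let $e=(u,v)$ be an edge of $G$ with $T(u)\neq T(v)$, and let $r_v$ be the root of $T(v)$. Then either $u=d(v)$ and $e$ is a bridge of $G(s)$, or $u$ is a proper descendant of $r_v$ in $D(s)$.
   Context: $G(s)$ is the flow graph with start vertex $s$; $u$ dominates $x$ if every path from $s$ to $x$ contains $u$ (reflexive). $D(s)$ is the dominator tree (rooted at $s$, $u$ ancestor of $x$ iff $u$ dominates $x$), and $d(x)$ the parent of $x\neq s$. An edge $(y,x)$ is a bridge of $G(s)$ if every path from $s$ to $x$ contains it (then $y=d(x)$). A vertex $x$ is marked if $(d(x),x)$ is a bridge of $G(s)$. Deleting from $D(s)$ all edges $(d(x),x)$ with $x$ marked yields a forest; $T(x)$ denotes the tree of this forest containing $x$; its root is $s$ or a marked vertex. -}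

module Defs where

open import Data.Nat using (ℕ)
open import Data.Fin using (Fin)
open import Data.Bool using (Bool; true)
open import Data.Product using (Σ; ∃; _×_; _,_)
open import Data.Sum using (_⊎_)
open import Relation.Nullary using (¬_)
open import Relation.Binary.PropositionalEquality using (_≡_; _≢_)

Graph : ℕ → Set
Graph n = Fin n → Fin n → Bool

module _ {n : ℕ} (G : Graph n) where

  IsEdge : Fin n → Fin n → Set
  IsEdge a b = G a b ≡ true

  data Walk : Fin n → Fin n → Set where
    []  : ∀ {a} → Walk a a
    _∷_ : ∀ {a b c} → IsEdge a b → Walk b c → Walk a c

  data OnWalk (w : Fin n) : ∀ {a b} → Walk a b → Set where
    here  : ∀ {b} {p : Walk w b} → OnWalk w {w} {b} p
    there : ∀ {a b c} {e : IsEdge a b} {p : Walk b c} → OnWalk w p → OnWalk w (e ∷ p)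

  data EdgeOnWalk (y x : Fin n) : ∀ {a b} → Walk a b → Set where
    here  : ∀ {c} {e : IsEdge y x} {p : Walk x c} → EdgeOnWalk y x (e ∷ p)
    there : ∀ {a b c} {e : IsEdge a b} {p : Walk b c} → EdgeOnWalk y x p → EdgeOnWalk y x (e ∷ p)

  StronglyConnected : Set
  StronglyConnected = ∀ a b → Walk a b

  module _ (s : Fin n) where

    Dom : Fin n → Fin n → Set
    Dom u x = ∀ (p : Walk s x) → OnWalk u p

    -- u = d(x): u is the parent of x ≠ s in the dominator tree D(s),
    -- i.e. u is a proper dominator of x dominated by every proper dominator of x
    IDom : Fin n → Fin n → Set
    IDom u x = x ≢ s × u ≢ x × Dom u x × (∀ w → Dom w x → w ≢ x → Dom w u)

    Bridge : Fin n → Fin n → Set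
    Bridge y x = IsEdge y x × (∀ (p : Walk s x) → EdgeOnWalk y x p)

    Marked : Fin n → Set
    Marked x = ∃ λ y → IDom y x × Bridge y x

    -- r is the root of T(x), the tree containing x in the forest obtained from
    -- D(s) by deleting the edges (d(w) , w) with w marked: r is an ancestor of x
    -- in D(s) (r dominates x), r is s or marked, and no vertex on the tree path
    -- from r (exclusive) to x (inclusive) is marked.
    RootT : Fin n → Fin n → Set
    RootT r x = Dom r x × (r ≡ s ⊎ Marked r)
              × (∀ w → Dom r w → Dom w x → w ≢ r → ¬ Marked w)

    SameT : Fin n → Fin n → Set
    SameT x y = ∃ λ r → RootT r x × RootT r y

    ProperDesc : Fin n → Fin n → Set
    ProperDesc x r = Dom r x × x ≢ r

-- The proof rests on three general facts about flow graphs.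
--   * Edge extension: if w properly dominates v and (u , v) is an edge, then
--     w dominates u (a walk s ⇝ u followed by the edge is a walk s ⇝ v).
--   * Bridge extension: if (y , x) is a bridge and (u , x) an edge with u ≠ y,
--     then x dominates u (the bridge lies on every walk s ⇝ u ⇝ x, hence before u).
--   * Antisymmetry: dominance between vertices reachable from s is
--     antisymmetric; consequently every root candidate (s or a marked vertex)
--     is the root of its own tree.
-- The theorem then follows by cases: rᵥ ≠ v uses edge extension and the fact
-- that u = rᵥ would put u in T(v); rᵥ = v = s is immediate; rᵥ = v marked with
-- bridge (y , v) is the first alternative when u = y, and bridge extension otherwise.
module Submission where

open import Defs
open import Data.Nat using (ℕ)
open import Data.Fin using (Fin; _≟_)
open import Data.Product using (_×_; _,_; Σ; proj₂)
open import Data.Sum using (_⊎_; inj₁; inj₂)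
open import Data.Empty using (⊥; ⊥-elim)
open import Relation.Nullary using (¬_; yes; no)
open import Relation.Binary.PropositionalEquality using (_≡_; refl; _≢_; sym)

module _ {n : ℕ} {G : Graph n} where

  _∷ʳ_ : ∀ {a b c} → Walk G a b → IsEdge G b c → Walk G a c
  []      ∷ʳ e = e ∷ []
  (f ∷ p) ∷ʳ e = f ∷ (p ∷ʳ e)

  on-end : ∀ {a b} (p : Walk G a b) → OnWalk G b p
  on-end []      = here
  on-end (e ∷ p) = there (on-end p)

  on-∷ʳ : ∀ {w a b c} (p : Walk G a b) (e : IsEdge G b c) →
          OnWalk G w (p ∷ʳ e) → OnWalk G w p ⊎ w ≡ c
  on-∷ʳ []      e here         = inj₁ here
  on-∷ʳ []      e (there here) = inj₂ refl
  on-∷ʳ (f ∷ p) e here         = inj₁ here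
  on-∷ʳ (f ∷ p) e (there o) with on-∷ʳ p e o
  ... | inj₁ o′ = inj₁ (there o′)
  ... | inj₂ eq = inj₂ eq

  edge-on-∷ʳ : ∀ {y x a b c} (p : Walk G a b) (e : IsEdge G b c) →
               EdgeOnWalk G y x (p ∷ʳ e) → EdgeOnWalk G y x p ⊎ y ≡ b
  edge-on-∷ʳ []      e here      = inj₂ refl
  edge-on-∷ʳ []      e (there ())
  edge-on-∷ʳ (f ∷ p) e here      = inj₁ here
  edge-on-∷ʳ (f ∷ p) e (there o) with edge-on-∷ʳ p e o
  ... | inj₁ o′ = inj₁ (there o′)
  ... | inj₂ eq = inj₂ eq

  edge-head-on : ∀ {y x a b} (p : Walk G a b) → EdgeOnWalk G y x p → OnWalk G x p
  edge-head-on (e ∷ p) here      = there here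
  edge-head-on (e ∷ p) (there o) = there (edge-head-on p o)

  Avoids : Fin n → ∀ {a c} → Walk G a c → Set
  Avoids b p = ¬ OnWalk G b p

  FirstArrival : ∀ {a b} → Walk G a b → Set
  FirstArrival {a} {b} q =
    ∀ c → OnWalk G c q → c ≢ b → Σ (Walk G a c) (Avoids b)

  first-arrival : ∀ {a b} → Walk G a b → Σ (Walk G a b) FirstArrival
  first-arrival [] = [] , λ { c here c≢b → ⊥-elim (c≢b refl) }
  first-arrival {a} {b} (e ∷ p) with a ≟ b
  ... | yes refl = [] , λ { c here c≢b → ⊥-elim (c≢b refl) }
  ... | no a≢b with first-arrival p
  ... | q , arrives = e ∷ q , extend
    where
    extend : FirstArrival (e ∷ q)
    extend c here      _   = [] , λ { here → a≢b refl }
    extend c (there o) c≢b with arrives c o c≢b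
    ... | r , avoids = e ∷ r , λ { here → a≢b refl ; (there o′) → avoids o′ }

  module _ (s : Fin n) where

    dom-refl : ∀ x → Dom G s x x
    dom-refl x = on-end

    dom-start : ∀ x → Dom G s s x
    dom-start x p = here

    dom-pred : ∀ {w u v} → IsEdge G u v → Dom G s w v → w ≢ v → Dom G s w u
    dom-pred e w-dom-v w≢v p with on-∷ʳ p e (w-dom-v (p ∷ʳ e))
    ... | inj₁ w-on-p = w-on-p
    ... | inj₂ w≡v    = ⊥-elim (w≢v w≡v)

    -- Bridge extension: if (y , x) is a bridge, x dominates every predecessor
    -- u ≠ y of x, since the bridge must occur on p ∷ʳ (u , x) before u.
    bridge-dom-pred : ∀ {y x u} → Bridge G s y x → IsEdge G u x → u ≢ y →
                      Dom G s x u
    bridge-dom-pred (_ , on-every) e u≢y p with edge-on-∷ʳ p e (on-every (p ∷ʳ e))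
    ... | inj₁ bridge-on-p = edge-head-on p bridge-on-p
    ... | inj₂ y≡u         = ⊥-elim (u≢y (sym y≡u))

    -- Antisymmetry: if b is reachable from s, and a, b dominate each other,
    -- then a = b; otherwise a first-arrival walk s ⇝ b yields a walk s ⇝ a
    -- avoiding b, contradicting that b dominates a.
    dom-antisym : ∀ {a b} → Walk G s b → Dom G s a b → Dom G s b a → a ≢ b → ⊥
    dom-antisym {a} p a-dom-b b-dom-a a≢b with first-arrival p
    ... | q , arrives with arrives a (a-dom-b q) a≢b
    ... | r , avoids = avoids (b-dom-a r)

    -- In a strongly connected graph, s and every marked vertex r are the root of
    -- their own tree T(r): by antisymmetry, the only vertex w with r dominating w
    -- and w dominating r is r itself.
    root-of-self : StronglyConnected G → ∀ {r} → r ≡ s ⊎ Marked G s r →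
                   RootT G s r r
    root-of-self sc {r} root =
      dom-refl r , root ,
      λ w r-dom-w w-dom-r w≢r → ⊥-elim (dom-antisym (sc s r) w-dom-r r-dom-w w≢r)

lemma6 : ∀ {n : ℕ} (G : Graph n) (s : Fin n) → StronglyConnected G →
         ∀ (u v : Fin n) → IsEdge G u v → ¬ SameT G s u v →
         ∀ (rv : Fin n) → RootT G s rv v →
         (IDom G s u v × Bridge G s u v) ⊎ ProperDesc G s u rv
lemma6 G s sc u v e different rv rt@(rv-dom-v , root , _) with u ≟ v
... | yes refl = ⊥-elim (different (rv , rt , rt))
... | no u≢v with rv ≟ v
-- rᵥ properly dominates v, hence dominates u; and u ≠ rᵥ, else T(u) = T(rᵥ) = T(v).
... | no rv≢v = inj₂ (dom-pred s e rv-dom-v rv≢v , u≢rv)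
  where
  u≢rv : u ≢ rv
  u≢rv refl = different (rv , root-of-self s sc root , rt)
... | yes refl with root
... | inj₁ refl = inj₂ (dom-start s u , u≢v)
... | inj₂ (y , y-idom-v , bridge) with u ≟ y
... | yes refl = inj₁ (y-idom-v , bridge)
... | no u≢y   = inj₂ (bridge-dom-pred s bridge e u≢y , u≢v)
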